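{- Let $d\geq 4$ and $n>d$. Define $$K(n,d-1)=\begin{cases}\overline{\{n-1,n\}}*B([1,n-2],2k-3) & \text{if } d=2k,\\ \overline{\{n-2,n-1,n\}}*B([1,n-3],2k-3) & \text{if } d=2k+1.\end{cases}$$ Then $K(n,d-1)$ is a subcomplex of $D(n,d-1)$, and $D(n+1,d-1)$ is the complex obtained from $D(n,d-1)$ by replacing $K(n,d-1)$ with $\partial K(n,d-1)*(n+1)$; that is, the facets of $D(n+1,d-1)$ are the facets of $D(n,d-1)$ that are not facets of $K(n,d-1)$, together with the sets $G\cup\{n+1\}$ for $G$ a facet of $\partial K(n,d-1)$.
   Context: For a finite set $V$, $\overline{V}$ is the simplex of all subsets of $V$. The join of complexes on disjoint vertex sets is $\Delta*\Gamma=\{F\cup G: F\in\Delta, G\in\Gamma\}$, and $\partial K*(n+1)$ denotes the cone $\partial K*\overline{\{n+1\}}$. For $k\ge1$ and $a<b$, $B([a,b],2k-1)$ is the pure complex generated by all sets $\{i_1,i_1+1,i_2,i_2+1,\dots,i_k,i_k+1\}$ with $a\le i_1$, $i_j+1<i_{j+1}$ for $1\le j<k$, and $i_k\le b-1$. For a pure complex $K$ that is a PL ball, $\partial K$ is the complex generated by its codimension-one faces lying in exactly one facet. For $J=(j_1,\dots,j_r)$ with all $j_i\ge2$ summing to $d+1$ and $n>d$, $\Gamma^J_n$ is the pure $d$-dimensional complex on $[n]$ generated by all unions $I_1\cup\dots\cup I_r$ of pairwise disjoint intervals of consecutive integers of sizes $j_1,\dots,j_r$ with each $I_i$ to the left of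 $I_{i+1}$ (a PL $d$-ball). For $d\ge4$ let $J=(2,\dots,2,3)$ if $d$ is even and $J=(2,\dots,2,4)$ if $d$ is odd (entries summing to $d+1$); $D(n,d-1)$ is the boundary complex of $\Gamma^J_n$. -}

module Defs where

open import Data.Nat using (ℕ; zero; suc; _+_; _∸_; _≤_; ⌊_/2⌋)
open import Data.Bool using (Bool; true; false; if_then_else_)
open import Data.List using (List; []; _∷_; _++_; map; upTo; replicate)
open import Data.List.Membership.Propositional using (_∈_; _∉_)
open import Data.Product using (Σ; _×_; ∃)

-- Finite vertex sets are lists of naturals, compared up to extensional equality.
VSet : Set
VSet = List ℕ

_⊆_ : VSet → VSet → Set
A ⊆ B = ∀ {x} → x ∈ A → x ∈ B

_≐_ : VSet → VSet → Set
A ≐ B = (A ⊆ B) × (B ⊆ A)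

-- A pure complex is described by the predicate "is a facet".
Family : Set₁
Family = VSet → Set

Face : Family → VSet → Set
Face F S = Σ VSet λ G → F G × S ⊆ G

CodimOne : VSet → VSet → Set
CodimOne G F = G ⊆ F × Σ ℕ λ v → v ∈ F × v ∉ G × F ⊆ (v ∷ G)

-- facets of the boundary of a pure complex (ball) with facets F:
-- codimension-one faces lying in exactly one facet
BoundaryFacet : Family → VSet → Set
BoundaryFacet F G =
  Σ VSet λ F₀ → F F₀ × CodimOne G F₀ ×
    (∀ F₁ → F F₁ → G ⊆ F₁ → F₁ ≐ F₀)

interval : ℕ → ℕ → VSet
interval s j = map (s +_) (upTo j)

-- Chain a J b T : T is a union I₁ ∪ ... ∪ I_r of intervals of sizes
-- J = (j₁,...,j_r), pairwise disjoint, each to the left of the next,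
-- all contained in [a, b].
data Chain : ℕ → List ℕ → ℕ → VSet → Set where
  done : ∀ {a b} → a ≤ suc b → Chain a [] b []
  step : ∀ {a b s j J T} → a ≤ s → Chain (s + j) J b T →
         Chain a (j ∷ J) b (interval s j ++ T)

ΓFacet : List ℕ → ℕ → Family
ΓFacet J n S = Σ VSet λ T → Chain 1 J n T × S ≐ T

-- facets of B([a,b], 2m-1)  (m pairs)
BFacet : ℕ → ℕ → ℕ → Family
BFacet a b m S = Σ VSet λ T → Chain a (replicate m 2) b T × S ≐ T

isEven : ℕ → Bool
isEven zero = true
isEven (suc zero) = false
isEven (suc (suc n)) = isEven n

-- k - 1 where d = 2k or d = 2k+1
pairs : ℕ → ℕ
pairs d = ⌊ d /2⌋ ∸ 1

Jseq : ℕ → List ℕ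
Jseq d = replicate (pairs d) 2 ++ ((if isEven d then 3 else 4) ∷ [])

-- facets of D(n, d-1) = ∂ Γ^J_n
DFacet : ℕ → ℕ → Family
DFacet d n = BoundaryFacet (ΓFacet (Jseq d) n)

topSize : ℕ → ℕ
topSize d = if isEven d then 2 else 3

-- facets of K(n,d-1) = simplex{n-t+1..n} * B([1,n-t], 2k-3), t = topSize d
KFacet : ℕ → ℕ → Family
KFacet d n S = Σ VSet λ T →
  BFacet 1 (n ∸ topSize d) (pairs d) T ×
  S ≐ (interval (suc n ∸ topSize d) (topSize d) ++ T)

{-# OPTIONS --safe #-}
module Submission where

-- Γ^J_{n+1} is Γ^J_n with the cone (n+1) * K(n,d-1) attached: a facet of Γ^J_{n+1} either lies in
-- [1, n], or its last block ends at n+1 and deleting n+1 leaves a facet of K(n,d-1). Once every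
-- facet of K(n,d-1) is known to be a boundary facet of Γ^J_n, the boundary of the glued ball is
-- (∂Γ^J_n minus K) together with (n+1) * ∂K by bookkeeping with faces alone. The combinatorial
-- core is that G = T ∪ [n-t+1, n] lies in exactly one facet of Γ^J_n, namely P ∪ [n-t, n], where P
-- is T with its maximal run of adjacent pairs ending at n-t shifted down by one; the shift has room
-- because n > d.

open import Defs
open import Data.Nat using (ℕ; zero; suc; _+_; _∸_; _≤_; _<_; z≤n; s≤s; z<s; ⌊_/2⌋)
open import Data.Nat.Properties
open import Data.Product using (Σ; _×_; _,_; proj₁; proj₂)
open import Data.Bool using (true; false)
open import Data.Sum using (_⊎_; inj₁; inj₂)
import Data.Sum as Sum
open import Data.Empty using (⊥-elim)
open import Function using (_∘_)
open import Function.Bundles using (_⇔_; mk⇔; Equivalence)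
open import Relation.Nullary using (¬_; ¬?; Dec; yes; no)
open import Data.List using (List; []; _∷_; _++_; replicate; filter)
open import Data.List.Properties using (++-assoc; ++-identityʳ)
open import Data.List.Membership.Propositional using (_∈_; _∉_)
open import Data.List.Membership.Propositional.Properties
  using (∈-++⁻; ∈-++⁺ˡ; ∈-++⁺ʳ; ∈-map⁻; ∈-map⁺; ∈-upTo⁻; ∈-upTo⁺; ∈-filter⁻; ∈-filter⁺)
open import Data.List.Relation.Unary.Any using (here; there)
open import Data.List.Relation.Binary.Subset.Propositional.Properties
  using (⊆-refl; ⊆-trans; ∷⁺ʳ; xs⊆x∷xs; ⊆∷∧∉⇒⊆; ⊆-reflexive-↭)
  renaming (++⁺ to ++⁺-⊆; ++⁺ʳ to ++⁺ʳ-⊆)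
open import Data.List.Relation.Binary.Permutation.Propositional using (_↭_; ↭-sym; ↭-trans)
open import Data.List.Relation.Binary.Permutation.Propositional.Properties using (++-comm; shift)
open import Relation.Binary.PropositionalEquality

≐-refl : ∀ {A} → A ≐ A
≐-refl = ⊆-refl , ⊆-refl

≐-reflexive : ∀ {A B} → A ≡ B → A ≐ B
≐-reflexive refl = ≐-refl

≐-sym : ∀ {A B} → A ≐ B → B ≐ A
≐-sym (A⊆B , B⊆A) = B⊆A , A⊆B

≐-trans : ∀ {A B C} → A ≐ B → B ≐ C → A ≐ C
≐-trans (A⊆B , B⊆A) (B⊆C , C⊆B) = ⊆-trans A⊆B B⊆C , ⊆-trans C⊆B B⊆A

↭⇒≐ : ∀ {A B} → A ↭ B → A ≐ B
↭⇒≐ A↭B = ⊆-reflexive-↭ A↭B , ⊆-reflexive-↭ (↭-sym A↭B)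

∷-≐ : ∀ {x A B} → A ≐ B → (x ∷ A) ≐ (x ∷ B)
∷-≐ {x} (A⊆B , B⊆A) = ∷⁺ʳ x A⊆B , ∷⁺ʳ x B⊆A

++-≐ : ∀ {A A′ B B′} → A ≐ A′ → B ≐ B′ → (A ++ B) ≐ (A′ ++ B′)
++-≐ (A⊆A′ , A′⊆A) (B⊆B′ , B′⊆B) = ++⁺-⊆ A⊆A′ B⊆B′ , ++⁺-⊆ A′⊆A B′⊆B

∷-≐⁻ : ∀ {v A B} → v ∉ A → v ∉ B → (v ∷ A) ≐ (v ∷ B) → A ≐ B
∷-≐⁻ v∉A v∉B (vA⊆vB , vB⊆vA) =
  ⊆∷∧∉⇒⊆ (λ x∈A → vA⊆vB (there x∈A)) v∉A , ⊆∷∧∉⇒⊆ (λ x∈B → vB⊆vA (there x∈B)) v∉B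

∈-∷-≢ : ∀ {x y : ℕ} {A : VSet} → y ≢ x → y ∈ x ∷ A → y ∈ A
∈-∷-≢ y≢x (here y≡x) = ⊥-elim (y≢x y≡x)
∈-∷-≢ y≢x (there y∈A) = y∈A

_≢?_ : (y v : ℕ) → Dec (y ≢ v)
y ≢? v = ¬? (y ≟ v)

remove : ℕ → VSet → VSet
remove v = filter (_≢? v)

∉-remove : ∀ {v} S → v ∉ remove v S
∉-remove {v} S v∈ = proj₂ (∈-filter⁻ (_≢? v) {xs = S} v∈) refl

∈⇒≐∷-remove : ∀ {v S} → v ∈ S → S ≐ (v ∷ remove v S)
∈⇒≐∷-remove {v} {S} v∈S = S⊆ , ∷⊆
  where
  S⊆ : S ⊆ (v ∷ remove v S)
  S⊆ {y} y∈S with y ≟ v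
  ... | yes refl = here refl
  ... | no y≢v = there (∈-filter⁺ (_≢? v) y∈S y≢v)
  ∷⊆ : (v ∷ remove v S) ⊆ S
  ∷⊆ (here refl) = v∈S
  ∷⊆ (there y∈) = proj₁ (∈-filter⁻ (_≢? v) {xs = S} y∈)

CodimOne-resp-≐ : ∀ {A A′ B B′} → A ≐ A′ → B ≐ B′ → CodimOne A B → CodimOne A′ B′
CodimOne-resp-≐ (A⊆A′ , A′⊆A) (B⊆B′ , B′⊆B) (A⊆B , w , w∈B , w∉A , B⊆wA) =
  ⊆-trans A′⊆A (⊆-trans A⊆B B⊆B′) , w , B⊆B′ w∈B , w∉A ∘ A′⊆A ,
  ⊆-trans B′⊆B (⊆-trans B⊆wA (∷⁺ʳ w A⊆A′))

CodimOne-insert : ∀ {v A} → v ∉ A → CodimOne A (v ∷ A)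
CodimOne-insert {v} {A} v∉A = xs⊆x∷xs A v , v , here refl , v∉A , ⊆-refl

CodimOne-++ˡ : ∀ {A B} C → (∀ {y} → y ∈ B → y ∉ C) → CodimOne A B → CodimOne (C ++ A) (C ++ B)
CodimOne-++ˡ {A} {B} C B∩C=∅ (A⊆B , w , w∈B , w∉A , B⊆wA) =
  ++⁺ʳ-⊆ C A⊆B , w , ∈-++⁺ʳ C w∈B , w∉CA , CB⊆wCA
  where
  w∉CA : w ∉ C ++ A
  w∉CA w∈CA with ∈-++⁻ C w∈CA
  ... | inj₁ w∈C = B∩C=∅ w∈B w∈C
  ... | inj₂ w∈A = w∉A w∈A
  CB⊆wCA : (C ++ B) ⊆ (w ∷ C ++ A)
  CB⊆wCA y∈CB with ∈-++⁻ C y∈CB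
  ... | inj₁ y∈C = there (∈-++⁺ˡ y∈C)
  ... | inj₂ y∈B with B⊆wA y∈B
  ...   | here y≡w = here y≡w
  ...   | there y∈A = there (∈-++⁺ʳ C y∈A)

CodimOne-∷⁻ : ∀ {v A B} → v ∉ A → v ∉ B → CodimOne (v ∷ A) (v ∷ B) → CodimOne A B
CodimOne-∷⁻ v∉A v∉B (vA⊆vB , w , w∈vB , w∉vA , vB⊆wvA) =
  ⊆∷∧∉⇒⊆ (λ y∈A → vA⊆vB (there y∈A)) v∉A , w , ∈-∷-≢ (w∉vA ∘ here) w∈vB , w∉vA ∘ there ,
  B⊆wA
  where
  B⊆wA : _ ⊆ (w ∷ _)
  B⊆wA y∈B with vB⊆wvA (there y∈B)
  ... | here y≡w = here y≡w
  ... | there y∈vA = there (∈-∷-≢ (λ { refl → v∉B y∈B }) y∈vA)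

CodimOne-⊆⇒⊇ : ∀ {S G F} → CodimOne S F → CodimOne G F → S ⊆ G → G ⊆ S
CodimOne-⊆⇒⊇ (_ , w , _ , _ , F⊆wS) (G⊆F , x , x∈F , x∉G , _) S⊆G y∈G with F⊆wS (G⊆F y∈G)
... | there y∈S = y∈S
... | here refl with F⊆wS x∈F
...   | here refl = ⊥-elim (x∉G y∈G)
...   | there x∈S = ⊥-elim (x∉G (S⊆G x∈S))

-- Γ⁺ is Γ with the cone v * K attached along K ⊆ ∂Γ.
record ConeGluing (Γ Γ⁺ K : Family) (v : ℕ) : Set₁ where
  field
    v∉Γ      : ∀ {F} → Γ F → v ∉ F
    K-resp-≐ : ∀ {G G′} → G ≐ G′ → K G → K G′
    K⊆∂Γ     : ∀ {G} → K G → BoundaryFacet Γ G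
    Γ⊆Γ⁺     : ∀ {F} → Γ F → Γ⁺ F
    cone⊆Γ⁺  : ∀ {G} → K G → Γ⁺ (v ∷ G)
    Γ⁺-split : ∀ {F} → Γ⁺ F → Γ F ⊎ Σ VSet λ G → K G × F ≐ (v ∷ G)

  v∉K : ∀ {G} → K G → v ∉ G
  v∉K KG v∈G with K⊆∂Γ KG
  ... | _ , ΓF , (G⊆F , _) , _ = v∉Γ ΓF (G⊆F v∈G)

module _ {Γ Γ⁺ K : Family} {v : ℕ} (gluing : ConeGluing Γ Γ⁺ K v) where
  open ConeGluing gluing

  GluedBoundaryFacet : VSet → Set
  GluedBoundaryFacet S =
    (BoundaryFacet Γ S × ¬ K S) ⊎ (Σ VSet λ G → BoundaryFacet K G × S ≐ (v ∷ G))

  Face-K⇒Face-∂Γ : ∀ S → Face K S → Face (BoundaryFacet Γ) S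
  Face-K⇒Face-∂Γ S (G , KG , S⊆G) = G , K⊆∂Γ KG , S⊆G

  ∂Γ⁺⇒glued : ∀ {S} → BoundaryFacet Γ⁺ S → GluedBoundaryFacet S
  ∂Γ⁺⇒glued {S} (F₀ , Γ⁺F₀ , cod@(S⊆F₀ , w , _ , w∉S , F₀⊆wS) , unique) with Γ⁺-split Γ⁺F₀
  ... | inj₁ ΓF₀ = inj₁ ((F₀ , ΓF₀ , cod , λ F₁ → unique F₁ ∘ Γ⊆Γ⁺) , ¬KS)
    where
    ¬KS : ¬ K S
    ¬KS KS = v∉Γ ΓF₀ (proj₁ (unique (v ∷ S) (cone⊆Γ⁺ KS) (xs⊆x∷xs S v)) (here refl))
  ... | inj₂ (G₀ , KG₀ , F₀≐vG₀) =
    inj₂ (G , (G₀ , KG₀ , codG , uniqueK) , S≐vG)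
    where
    -- Otherwise S ⊆ G₀, and the Γ-facet through G₀ would be a Γ⁺-facet containing S other than F₀.
    v∈S : v ∈ S
    v∈S with F₀⊆wS (proj₂ F₀≐vG₀ (here refl))
    ... | there v∈S = v∈S
    ... | here refl with K⊆∂Γ KG₀
    ...   | F′ , ΓF′ , (G₀⊆F′ , _) , _ =
      ⊥-elim (v∉Γ ΓF′ (proj₂ (unique F′ (Γ⊆Γ⁺ ΓF′) (G₀⊆F′ ∘ S⊆G₀)) (proj₂ F₀≐vG₀ (here refl))))
      where
      S⊆G₀ : S ⊆ G₀
      S⊆G₀ = ⊆∷∧∉⇒⊆ (proj₁ F₀≐vG₀ ∘ S⊆F₀) w∉S
    G = remove v S
    S≐vG : S ≐ (v ∷ G)
    S≐vG = ∈⇒≐∷-remove v∈S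
    codG : CodimOne G G₀
    codG = CodimOne-∷⁻ (∉-remove S) (v∉K KG₀) (CodimOne-resp-≐ S≐vG F₀≐vG₀ cod)
    uniqueK : ∀ F₁ → K F₁ → G ⊆ F₁ → F₁ ≐ G₀
    uniqueK F₁ KF₁ G⊆F₁ =
      ∷-≐⁻ (v∉K KF₁) (v∉K KG₀)
        (≐-trans (unique (v ∷ F₁) (cone⊆Γ⁺ KF₁) (⊆-trans (proj₁ S≐vG) (∷⁺ʳ v G⊆F₁))) F₀≐vG₀)

  glued⇒∂Γ⁺ : ∀ {S} → GluedBoundaryFacet S → BoundaryFacet Γ⁺ S
  glued⇒∂Γ⁺ {S} (inj₁ ((F₀ , ΓF₀ , cod , unique) , ¬KS)) = F₀ , Γ⊆Γ⁺ ΓF₀ , cod , unique⁺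
    where
    unique⁺ : ∀ F₁ → Γ⁺ F₁ → S ⊆ F₁ → F₁ ≐ F₀
    unique⁺ F₁ Γ⁺F₁ S⊆F₁ with Γ⁺-split Γ⁺F₁
    ... | inj₁ ΓF₁ = unique F₁ ΓF₁ S⊆F₁
    ... | inj₂ (G , KG , F₁≐vG) with K⊆∂Γ KG
    ...   | Fᴳ , ΓFᴳ , codG , _ = ⊥-elim (¬KS (K-resp-≐ (G⊆S , S⊆G) KG))
      where
      S⊆G : S ⊆ G
      S⊆G = ⊆∷∧∉⇒⊆ (proj₁ F₁≐vG ∘ S⊆F₁) (v∉Γ ΓF₀ ∘ proj₁ cod)
      -- Both S and G are codimension-one faces of F₀.
      G⊆S : G ⊆ S
      G⊆S = CodimOne-⊆⇒⊇ cod
              (CodimOne-resp-≐ ≐-refl (unique Fᴳ ΓFᴳ (proj₁ codG ∘ S⊆G)) codG) S⊆G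
  glued⇒∂Γ⁺ {S} (inj₂ (G , (Fᴷ , KFᴷ , codK , uniqueK) , S≐vG)) =
    v ∷ Fᴷ , cone⊆Γ⁺ KFᴷ ,
    CodimOne-resp-≐ (≐-sym S≐vG) ≐-refl
      (CodimOne-++ˡ (v ∷ []) (λ { y∈Fᴷ (here refl) → v∉K KFᴷ y∈Fᴷ }) codK) ,
    unique⁺
    where
    unique⁺ : ∀ F₁ → Γ⁺ F₁ → S ⊆ F₁ → F₁ ≐ (v ∷ Fᴷ)
    unique⁺ F₁ Γ⁺F₁ S⊆F₁ with Γ⁺-split Γ⁺F₁
    ... | inj₁ ΓF₁ = ⊥-elim (v∉Γ ΓF₁ (S⊆F₁ (proj₂ S≐vG (here refl))))
    ... | inj₂ (G₁ , KG₁ , F₁≐vG₁) = ≐-trans F₁≐vG₁ (∷-≐ (uniqueK G₁ KG₁ G⊆G₁))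
      where
      G⊆G₁ : G ⊆ G₁
      G⊆G₁ = ⊆∷∧∉⇒⊆ (proj₁ F₁≐vG₁ ∘ S⊆F₁ ∘ proj₂ S≐vG ∘ there) (v∉K KFᴷ ∘ proj₁ codK)

  ∂Γ⁺⇔glued : ∀ S → BoundaryFacet Γ⁺ S ⇔ GluedBoundaryFacet S
  ∂Γ⁺⇔glued S = mk⇔ ∂Γ⁺⇒glued glued⇒∂Γ⁺

ConeGluing-respᴷ : ∀ {Γ Γ⁺ K K′ v} → (∀ {G} → K G ⇔ K′ G) →
  ConeGluing Γ Γ⁺ K′ v → ConeGluing Γ Γ⁺ K v
ConeGluing-respᴷ {K = K} {K′} K⇔K′ gluing = record
  { v∉Γ      = v∉Γ
  ; K-resp-≐ = λ G≐G′ → from ∘ K-resp-≐ G≐G′ ∘ to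
  ; K⊆∂Γ     = K⊆∂Γ ∘ to
  ; Γ⊆Γ⁺     = Γ⊆Γ⁺
  ; cone⊆Γ⁺  = cone⊆Γ⁺ ∘ to
  ; Γ⁺-split = Sum.map₂ (λ (G , K′G , F≐vG) → G , from K′G , F≐vG) ∘ Γ⁺-split
  }
  where
  open ConeGluing gluing
  to : ∀ {G} → K G → K′ G
  to = Equivalence.to K⇔K′
  from : ∀ {G} → K′ G → K G
  from = Equivalence.from K⇔K′

∈-interval⁻ : ∀ {s j x} → x ∈ interval s j → s ≤ x × x < s + j
∈-interval⁻ {s} x∈ with ∈-map⁻ (s +_) x∈
... | i , i∈ , refl = m≤m+n s i , +-monoʳ-< s (∈-upTo⁻ i∈)

∈-interval⁺ : ∀ {s j x} → s ≤ x → x < s + j → x ∈ interval s j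
∈-interval⁺ {s} {j} {x} s≤x x<s+j =
  subst (_∈ interval s j) (m+[n∸m]≡n s≤x)
    (∈-map⁺ (s +_) (∈-upTo⁺ (+-cancelˡ-< s _ j (subst (_< s + j) (sym (m+[n∸m]≡n s≤x)) x<s+j))))

interval-2 : ∀ s → interval s 2 ≡ s ∷ suc s ∷ []
interval-2 s = cong₂ (λ a b → a ∷ b ∷ []) (+-identityʳ s) (+-comm s 1)

interval-∷ʳ : ∀ s j → interval s (suc j) ≐ (s + j ∷ interval s j)
interval-∷ʳ s j = to , from
  where
  to : interval s (suc j) ⊆ (s + j ∷ interval s j)
  to {x} x∈ with ∈-interval⁻ x∈
  ... | s≤x , x<s+1+j with m≤n⇒m<n∨m≡n (≤-pred (subst (x <_) (+-suc s j) x<s+1+j))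
  ...   | inj₁ x<s+j = there (∈-interval⁺ s≤x x<s+j)
  ...   | inj₂ x≡s+j = here x≡s+j
  from : (s + j ∷ interval s j) ⊆ interval s (suc j)
  from (here refl) = ∈-interval⁺ (m≤m+n s j) (+-monoʳ-< s (n<1+n j))
  from (there x∈) with ∈-interval⁻ x∈
  ... | s≤x , x<s+j = ∈-interval⁺ s≤x (<-trans x<s+j (+-monoʳ-< s (n<1+n j)))

interval-∷ : ∀ s j → interval s (suc j) ≐ (s ∷ interval (suc s) j)
interval-∷ s j = to , from
  where
  to : interval s (suc j) ⊆ (s ∷ interval (suc s) j)
  to {x} x∈ with ∈-interval⁻ x∈
  ... | s≤x , x<s+1+j with m≤n⇒m<n∨m≡n s≤x
  ...   | inj₁ s<x = there (∈-interval⁺ s<x (subst (x <_) (+-suc s j) x<s+1+j))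
  ...   | inj₂ refl = here refl
  from : (s ∷ interval (suc s) j) ⊆ interval s (suc j)
  from (here refl) = ∈-interval⁺ ≤-refl (m<m+n s z<s)
  from {x} (there x∈) with ∈-interval⁻ x∈
  ... | s<x , x<1+s+j = ∈-interval⁺ (<⇒≤ s<x) (subst (x <_) (sym (+-suc s j)) x<1+s+j)

Chain-start≤ : ∀ {a J b T} → Chain a J b T → a ≤ suc b
Chain-start≤ (done a≤1+b) = a≤1+b
Chain-start≤ (step {s = s} {j = j} a≤s c) = ≤-trans a≤s (≤-trans (m≤m+n s j) (Chain-start≤ c))

Chain-∈⇒≤ : ∀ {a J b T x} → Chain a J b T → x ∈ T → x ≤ b
Chain-∈⇒≤ (step {s = s} {j = j} _ c) x∈ with ∈-++⁻ (interval s j) x∈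
... | inj₁ x∈I = ≤-pred (≤-trans (proj₂ (∈-interval⁻ x∈I)) (Chain-start≤ c))
... | inj₂ x∈T = Chain-∈⇒≤ c x∈T

Chain-weaken : ∀ {a J b b′ T} → b ≤ b′ → Chain a J b T → Chain a J b′ T
Chain-weaken b≤b′ (done a≤1+b) = done (≤-trans a≤1+b (s≤s b≤b′))
Chain-weaken b≤b′ (step a≤s c) = step a≤s (Chain-weaken b≤b′ c)

Chain-∷ʳ⁻ : ∀ J {a j b T} → Chain (suc a) (J ++ j ∷ []) b T →
  Σ ℕ λ s → Σ VSet λ T₁ →
    Chain (suc a) J s T₁ × suc s + j ≤ suc b × T ≡ T₁ ++ interval (suc s) j ++ []
Chain-∷ʳ⁻ [] (step {s = suc s} (s≤s a≤s) (done 1+s+j≤1+b)) =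
  s , [] , done (s≤s a≤s) , 1+s+j≤1+b , refl
Chain-∷ʳ⁻ (i ∷ J) (step {s = suc s₁} (s≤s a≤s₁) c) with Chain-∷ʳ⁻ J c
... | s , T₁ , c₁ , 1+s+j≤1+b , refl =
  s , interval (suc s₁) i ++ T₁ , step (s≤s a≤s₁) c₁ , 1+s+j≤1+b ,
  sym (++-assoc (interval (suc s₁) i) T₁ _)

Chain-∷ʳ⁺ : ∀ {a J s j b T₁} → Chain a J s T₁ → suc s + j ≤ suc b →
  Chain a (J ++ j ∷ []) b (T₁ ++ interval (suc s) j ++ [])
Chain-∷ʳ⁺ (done a≤1+s) 1+s+j≤1+b = step a≤1+s (done 1+s+j≤1+b)
Chain-∷ʳ⁺ {a} {b = b} (step {s = s₁} {j = i} {T = T} a≤s₁ c) 1+s+j≤1+b =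
  subst (Chain a _ b) (sym (++-assoc (interval s₁ i) T _)) (step a≤s₁ (Chain-∷ʳ⁺ c 1+s+j≤1+b))

-- Pairs q b T : T is a union of q disjoint pairs {i, i+1} ⊆ [1, b], listed from the top pair
-- down; up to ≐ these are the facets of B([1,b], 2q-1).
data Pairs : ℕ → ℕ → VSet → Set where
  noPairs : ∀ {b} → Pairs 0 b []
  addPair : ∀ {q s b T} → Pairs q s T → suc (suc s) ≤ b → Pairs (suc q) b (suc s ∷ suc (suc s) ∷ T)

replicate-∷ʳ : ∀ {A : Set} q (x : A) → replicate (suc q) x ≡ replicate q x ++ x ∷ []
replicate-∷ʳ zero    x = refl
replicate-∷ʳ (suc q) x = cong (x ∷_) (replicate-∷ʳ q x)

pair-block≐ : ∀ {s T T′} → T ≐ T′ → (T ++ interval (suc s) 2 ++ []) ≐ (suc s ∷ suc (suc s) ∷ T′)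
pair-block≐ {s} {T′ = T′} T≐T′ =
  ≐-trans (++-≐ T≐T′ (≐-reflexive (cong (_++ []) (interval-2 (suc s)))))
          (↭⇒≐ (++-comm T′ (suc s ∷ suc (suc s) ∷ [])))

PairChain⇒Pairs : ∀ q {b T} → Chain 1 (replicate q 2) b T → Σ VSet λ T′ → Pairs q b T′ × T ≐ T′
PairChain⇒Pairs zero (done _) = [] , noPairs , ≐-refl
PairChain⇒Pairs (suc q) {b} {T} c
  with Chain-∷ʳ⁻ (replicate q 2) (subst (λ J → Chain 1 J b T) (replicate-∷ʳ q 2) c)
... | s , T₁ , c₁ , 3+s≤1+b , T≡ with PairChain⇒Pairs q c₁
...   | T₁′ , ps , T₁≐T₁′ =
  suc s ∷ suc (suc s) ∷ T₁′ , addPair ps (subst (_≤ b) (+-comm s 2) (≤-pred 3+s≤1+b)) ,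
  ≐-trans (≐-reflexive T≡) (pair-block≐ T₁≐T₁′)

Pairs⇒PairChain : ∀ {q b T} → Pairs q b T → Σ VSet λ T′ → Chain 1 (replicate q 2) b T′ × T ≐ T′
Pairs⇒PairChain noPairs = [] , done (s≤s z≤n) , ≐-refl
Pairs⇒PairChain (addPair {q} {s} {b} ps 2+s≤b) with Pairs⇒PairChain ps
... | T′ , c , T≐T′ =
  T′ ++ interval (suc s) 2 ++ [] ,
  subst (λ J → Chain 1 J b _) (sym (replicate-∷ʳ q 2))
    (Chain-∷ʳ⁺ c (subst (_≤ suc b) (cong suc (+-comm 2 s)) (s≤s 2+s≤b))) ,
  ≐-sym (pair-block≐ (≐-sym T≐T′))

Pairs-≤ : ∀ {q b T x} → Pairs q b T → x ∈ T → x ≤ b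
Pairs-≤ (addPair _ 2+s≤b) (here refl) = ≤-trans (n≤1+n _) 2+s≤b
Pairs-≤ (addPair _ 2+s≤b) (there (here refl)) = 2+s≤b
Pairs-≤ (addPair {s = s} ps 2+s≤b) (there (there x∈T)) =
  ≤-trans (Pairs-≤ ps x∈T) (≤-trans (m≤n+m s 2) 2+s≤b)

Pairs-∷-≤ : ∀ {q b P x} → Pairs q b P → x ∈ suc b ∷ P → x ≤ suc b
Pairs-∷-≤ _  (here refl) = ≤-refl
Pairs-∷-≤ ps (there x∈P) = m≤n⇒m≤1+n (Pairs-≤ ps x∈P)

∈-pair-∷⁻ : ∀ {y r P} → y ≤ suc r → y ∈ (suc r ∷ suc (suc r) ∷ P) → y ∈ (suc r ∷ P)
∈-pair-∷⁻ _      (here y≡1+r) = here y≡1+r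
∈-pair-∷⁻ y≤1+r (there y∈)   = there (∈-∷-≢ (<⇒≢ (s≤s y≤1+r)) y∈)

∈-below-pair : ∀ {y r P} → y ≤ r → y ∈ (suc r ∷ suc (suc r) ∷ P) → y ∈ P
∈-below-pair y≤r y∈ = ∈-∷-≢ (<⇒≢ (s≤s y≤r)) (∈-pair-∷⁻ (m≤n⇒m≤1+n y≤r) y∈)

Pairs-⊆-∷⇒≤ : ∀ {k q b c x T P} → Pairs k b T → Pairs q c P → c < x → T ⊆ (x ∷ P) → k ≤ q
Pairs-⊆-∷⇒≤ noPairs _ _ _ = z≤n
Pairs-⊆-∷⇒≤ (addPair _ _) noPairs _ T⊆x with T⊆x (here refl) | T⊆x (there (here refl))
... | here refl | here ()
... | here _    | there ()
... | there ()  | _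
Pairs-⊆-∷⇒≤ {x = x} (addPair {s = s} ts _) (addPair {s = r} {T = P′} ps 2+r≤c) c<x T⊆xP =
  s≤s (Pairs-⊆-∷⇒≤ ts ps (n<1+n r) T′⊆)
  where
  2+r<x : suc (suc r) < x
  2+r<x = ≤-<-trans 2+r≤c c<x
  s≤1+r : s ≤ suc r
  s≤1+r with T⊆xP (here refl)
  ... | there 1+s∈P = ≤-pred (Pairs-≤ (addPair ps ≤-refl) 1+s∈P)
  ... | here refl with T⊆xP (there (here refl))
  ...   | here ()
  ...   | there 2+s∈P = ⊥-elim (1+n≰n (≤-trans (Pairs-≤ (addPair ps ≤-refl) 2+s∈P) (<⇒≤ 2+r<x)))
  T′⊆ : _ ⊆ (suc r ∷ P′)
  T′⊆ y∈T′ = ∈-pair-∷⁻ y≤1+r (∈-∷-≢ (<⇒≢ (≤-<-trans y≤1+r (<-trans (n<1+n _) 2+r<x))) y∈xP)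
    where
    y≤1+r = ≤-trans (Pairs-≤ ts y∈T′) s≤1+r
    y∈xP = T⊆xP (there (there y∈T′))

Pairs-⊆⇒⊇ : ∀ {q b c T P} → Pairs q b T → Pairs q c P → T ⊆ P → P ⊆ T
Pairs-⊆⇒⊇ noPairs noPairs _ = λ ()
Pairs-⊆⇒⊇ (addPair {s = s} ts _) (addPair {s = r} {T = P′} ps _) T⊆P
  with m≤n⇒m<n∨m≡n (Pairs-≤ (addPair ps ≤-refl) (T⊆P (there (here refl))))
... | inj₁ 2+s<2+r =
  ⊥-elim (1+n≰n (Pairs-⊆-∷⇒≤ (addPair ts ≤-refl) ps (n<1+n r) T⊆1+r∷P′))
  where
  T⊆1+r∷P′ : _ ⊆ (suc r ∷ P′)
  T⊆1+r∷P′ y∈T = ∈-pair-∷⁻ (≤-pred (≤-<-trans (Pairs-≤ (addPair ts ≤-refl) y∈T) 2+s<2+r)) (T⊆P y∈T)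
... | inj₂ refl = P⊆T
  where
  P⊆T : _ ⊆ _
  P⊆T (here refl) = here refl
  P⊆T (there (here refl)) = there (here refl)
  P⊆T (there (there y∈P′)) =
    there (there (Pairs-⊆⇒⊇ ts ps
      (λ y∈T′ → ∈-below-pair (Pairs-≤ ts y∈T′) (T⊆P (there (there y∈T′)))) y∈P′))

Pairs-top-pair : ∀ {q t s P} → Pairs q t P → suc (suc t) ≤ suc s →
  suc s ∈ (suc (suc s) ∷ suc t ∷ suc (suc t) ∷ P) → s ≡ suc t
Pairs-top-pair _ 2+t≤1+s (here ())
Pairs-top-pair _ 2+t≤1+s (there (here refl)) = ⊥-elim (1+n≰n 2+t≤1+s)
Pairs-top-pair _ _ (there (there (here 1+s≡2+t))) = suc-injective 1+s≡2+t
Pairs-top-pair ps 2+t≤1+s (there (there (there 1+s∈P))) =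
  ⊥-elim (1+n≰n (≤-trans 2+t≤1+s (m≤n⇒m≤1+n (Pairs-≤ ps 1+s∈P))))

Pairs-cover-⊆ : ∀ {q m T P₁ P₂} → Pairs q (suc m) T → Pairs q m P₁ → Pairs q m P₂ →
  T ⊆ (suc m ∷ P₁) → T ⊆ (suc m ∷ P₂) → P₁ ⊆ P₂
Pairs-cover-⊆ noPairs noPairs _ _ _ = λ ()
Pairs-cover-⊆ {m = m} {T} (addPair {s = s} ts 2+s≤1+m) ps₁ ps₂ T⊆₁ T⊆₂
  with m≤n⇒m<n∨m≡n 2+s≤1+m
... | inj₁ 2+s<1+m = ⊆-trans (Pairs-⊆⇒⊇ (addPair ts ≤-refl) ps₁ (below T⊆₁)) (below T⊆₂)
  where
  below : ∀ {P} → T ⊆ (suc m ∷ P) → T ⊆ P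
  below T⊆ = ⊆∷∧∉⇒⊆ T⊆ (λ 1+m∈T → <⇒≱ 2+s<1+m (Pairs-≤ (addPair ts ≤-refl) 1+m∈T))
Pairs-cover-⊆ (addPair ts _) (addPair {s = t} ps₁ 2+t≤1+s) (addPair ps₂ 2+t₂≤1+s) T⊆₁ T⊆₂
  | inj₂ refl
  with Pairs-top-pair ps₁ 2+t≤1+s (T⊆₁ (here refl))
     | Pairs-top-pair ps₂ 2+t₂≤1+s (T⊆₂ (here refl))
... | refl | refl = ∷⁺ʳ _ (∷⁺ʳ _ (Pairs-cover-⊆ ts ps₁ ps₂ (below T⊆₁) (below T⊆₂)))
  where
  below : ∀ {P} → _ ⊆ (suc (suc (suc t)) ∷ suc t ∷ suc (suc t) ∷ P) → _ ⊆ (suc t ∷ P)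
  below T⊆ y∈T′ =
    ∈-pair-∷⁻ (Pairs-≤ ts y∈T′)
      (∈-∷-≢ (<⇒≢ (s≤s (m≤n⇒m≤1+n (Pairs-≤ ts y∈T′)))) (T⊆ (there (there y∈T′))))

-- If m+1 ∈ T, the top pair {m, m+1} of T becomes {m-1, m} in P and the recursion continues below.
Pairs-cover : ∀ {q m T} → Pairs q (suc m) T → q + q ≤ m →
  Σ VSet λ P → Pairs q m P × CodimOne T (suc m ∷ P)
Pairs-cover noPairs _ = [] , noPairs , CodimOne-insert (λ ())
Pairs-cover (addPair {s = s} ts 2+s≤1+m) _ with m≤n⇒m<n∨m≡n 2+s≤1+m
... | inj₁ 2+s<1+m =
  _ , addPair ts (≤-pred 2+s<1+m) ,
  CodimOne-insert (λ 1+m∈T → <⇒≱ 2+s<1+m (Pairs-≤ (addPair ts ≤-refl) 1+m∈T))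
Pairs-cover (addPair {q} {zero} _ _) 2q≤m | inj₂ refl =
  ⊥-elim (n≮0 (subst (_≤ 0) (+-suc q q) (≤-pred 2q≤m)))
Pairs-cover (addPair {q} {suc s} ts _) 2q≤m | inj₂ refl
  with Pairs-cover ts (≤-pred (subst (_≤ suc s) (+-suc q q) (≤-pred 2q≤m)))
... | P′ , ps′ , cod′ =
  suc s ∷ suc (suc s) ∷ P′ , addPair ps′ ≤-refl ,
  CodimOne-resp-≐ ≐-refl (↭⇒≐ (↭-sym (shift (suc (suc s)) (suc (suc (suc s)) ∷ suc s ∷ []) P′)))
    (CodimOne-++ˡ (suc (suc s) ∷ suc (suc (suc s)) ∷ []) above-P′ cod′)
  where
  above-P′ : ∀ {y} → y ∈ suc s ∷ P′ → y ∉ suc (suc s) ∷ suc (suc (suc s)) ∷ []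
  above-P′ y∈ (here refl) = 1+n≰n (Pairs-∷-≤ ps′ y∈)
  above-P′ y∈ (there (here refl)) = 1+n≰n (≤-trans (n≤1+n _) (Pairs-∷-≤ ps′ y∈))

pairsThen : ℕ → ℕ → List ℕ
pairsThen p t = replicate p 2 ++ suc t ∷ []

BlockFacet : ℕ → ℕ → ℕ → Family
BlockFacet p t k F = Σ ℕ λ s → Σ VSet λ P →
  Pairs p s P × suc s + suc t ≤ suc k × F ≐ (P ++ interval (suc s) (suc t))

ΓFacet⇒BlockFacet : ∀ {p t k F} → ΓFacet (pairsThen p t) k F → BlockFacet p t k F
ΓFacet⇒BlockFacet {p} (U , c , F≐U) with Chain-∷ʳ⁻ (replicate p 2) c
... | s , T , c₁ , 1+s+1+t≤1+k , refl with PairChain⇒Pairs p c₁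
...   | P , ps , T≐P =
  s , P , ps , 1+s+1+t≤1+k , ≐-trans F≐U (++-≐ T≐P (≐-reflexive (++-identityʳ _)))

BlockFacet⇒ΓFacet : ∀ {p t k F} → BlockFacet p t k F → ΓFacet (pairsThen p t) k F
BlockFacet⇒ΓFacet {t = t} (s , P , ps , 1+s+1+t≤1+k , F≐) with Pairs⇒PairChain ps
... | T , c , P≐T =
  T ++ interval (suc s) (suc t) ++ [] , Chain-∷ʳ⁺ c 1+s+1+t≤1+k ,
  ≐-trans F≐ (++-≐ P≐T (≐-reflexive (sym (++-identityʳ _))))

ΓFacet-∌ : ∀ {J k F} → ΓFacet J k F → suc k ∉ F
ΓFacet-∌ (_ , c , F≐T) 1+k∈F = 1+n≰n (Chain-∈⇒≤ c (proj₁ F≐T 1+k∈F))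

ΓFacet-suc : ∀ {J k F} → ΓFacet J k F → ΓFacet J (suc k) F
ΓFacet-suc (T , c , F≐T) = T , Chain-weaken (n≤1+n _) c , F≐T

-- KFacet d n reparametrised by p = pairs d, t = topSize d and n = suc m + t, which avoids
-- the truncated subtractions n ∸ t and suc n ∸ t.
KFacet′ : ℕ → ℕ → ℕ → Family
KFacet′ p t m G = Σ VSet λ T → Pairs p (suc m) T × G ≐ (interval (suc (suc m)) t ++ T)

KFacet′-resp-≐ : ∀ {p t m G G′} → G ≐ G′ → KFacet′ p t m G → KFacet′ p t m G′
KFacet′-resp-≐ G≐G′ (T , ts , G≐) = T , ts , ≐-trans (≐-sym G≐G′) G≐

block-start : ∀ {s m t} → s + suc t ≡ suc (m + t) → s ≡ m
block-start {s} {m} {t} e = +-cancelʳ-≡ (suc t) s m (trans e (sym (+-suc m t)))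

module Gluing (p t m : ℕ) where
  n : ℕ
  n = suc m + t

  cone≐block : ∀ {G T} → G ≐ (interval (suc (suc m)) t ++ T) →
    (suc n ∷ G) ≐ (T ++ interval (suc (suc m)) (suc t))
  cone≐block {T = T} G≐ =
    ≐-trans (∷-≐ G≐)
      (≐-trans (↭⇒≐ (++-comm (suc n ∷ interval (suc (suc m)) t) T))
               (++-≐ ≐-refl (≐-sym (interval-∷ʳ (suc (suc m)) t))))

  cone∈Γ⁺ : ∀ {G} → KFacet′ p t m G → ΓFacet (pairsThen p t) (suc n) (suc n ∷ G)
  cone∈Γ⁺ (T , ts , G≐) =
    BlockFacet⇒ΓFacet (suc m , T , ts , ≤-reflexive (cong (suc ∘ suc) (+-suc m t)) , cone≐block G≐)

  Γ⁺-split : ∀ {F} → ΓFacet (pairsThen p t) (suc n) F →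
    ΓFacet (pairsThen p t) n F ⊎ Σ VSet λ G → KFacet′ p t m G × F ≐ (suc n ∷ G)
  Γ⁺-split ΓF with ΓFacet⇒BlockFacet ΓF
  ... | s , P , ps , 1+s+1+t≤2+n , F≐ with m≤n⇒m<n∨m≡n 1+s+1+t≤2+n
  ...   | inj₁ 1+s+1+t<2+n = inj₁ (BlockFacet⇒ΓFacet (s , P , ps , ≤-pred 1+s+1+t<2+n , F≐))
  ...   | inj₂ 1+s+1+t≡2+n with block-start (suc-injective 1+s+1+t≡2+n)
  ...     | refl =
    inj₂ (interval (suc (suc m)) t ++ P , (P , ps , ≐-refl) ,
          ≐-trans F≐ (≐-sym (cone≐block ≐-refl)))

  n∈top : 1 ≤ t → n ∈ interval (suc (suc m)) t
  n∈top 1≤t = ∈-interval⁺ (subst (_≤ n) (+-comm (suc m) 1) (+-monoʳ-≤ (suc m) 1≤t)) ≤-refl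

  top-in-block : ∀ {s P} → Pairs p s P → suc s + suc t ≤ suc n →
    n ∈ (P ++ interval (suc s) (suc t)) → s ≡ m
  top-in-block {s} {P} ps 1+s+1+t≤1+n n∈ with ∈-++⁻ P n∈
  ... | inj₁ n∈P = ⊥-elim (<⇒≱ s<n (Pairs-≤ ps n∈P))
    where
    s<n : s < n
    s<n = ≤-trans (s≤s (m≤m+n s t)) (subst (_≤ n) (+-suc s t) (≤-pred 1+s+1+t≤1+n))
  ... | inj₂ n∈I =
    block-start (suc-injective (≤-antisym 1+s+1+t≤1+n (proj₂ (∈-interval⁻ n∈I))))

  -- n ∈ G pins the last block of F₁ to [m+1, n]; its pairs then cover T, hence equal P.
  facet⊇K-unique : ∀ {T P F₁} → 1 ≤ t → Pairs p (suc m) T → Pairs p m P → T ⊆ (suc m ∷ P) →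
    ΓFacet (pairsThen p t) n F₁ → (interval (suc (suc m)) t ++ T) ⊆ F₁ →
    F₁ ≐ (P ++ interval (suc m) (suc t))
  facet⊇K-unique {T} 1≤t ts ps T⊆ ΓF₁ K⊆F₁ with ΓFacet⇒BlockFacet ΓF₁
  ... | s , P₁ , ps₁ , 1+s+1+t≤1+n , F₁≐
    with top-in-block ps₁ 1+s+1+t≤1+n (proj₁ F₁≐ (K⊆F₁ (∈-++⁺ˡ (n∈top 1≤t))))
  ... | refl =
    ≐-trans F₁≐ (++-≐ (Pairs-cover-⊆ ts ps₁ ps T⊆P₁ T⊆ , Pairs-cover-⊆ ts ps ps₁ T⊆ T⊆P₁) ≐-refl)
    where
    T⊆P₁ : T ⊆ (suc m ∷ P₁)
    T⊆P₁ y∈T with ∈-++⁻ P₁ (proj₁ F₁≐ (K⊆F₁ (∈-++⁺ʳ (interval (suc (suc m)) t) y∈T)))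
    ... | inj₁ y∈P₁ = there y∈P₁
    ... | inj₂ y∈I = here (≤-antisym (Pairs-≤ ts y∈T) (proj₁ (∈-interval⁻ y∈I)))

  K⊆∂Γ : 1 ≤ t → p + p ≤ m → ∀ {G} → KFacet′ p t m G → BoundaryFacet (ΓFacet (pairsThen p t) n) G
  K⊆∂Γ 1≤t 2p≤m (T , ts , G≐) with Pairs-cover ts 2p≤m
  ... | P , ps , cod =
    P ++ interval (suc m) (suc t) ,
    BlockFacet⇒ΓFacet (m , P , ps , ≤-reflexive (cong suc (+-suc m t)) , ≐-refl) ,
    CodimOne-resp-≐ (≐-sym G≐) (≐-sym F₀≐) (CodimOne-++ˡ I below-I cod) ,
    λ F₁ ΓF₁ G⊆F₁ → facet⊇K-unique 1≤t ts ps (proj₁ cod) ΓF₁ (G⊆F₁ ∘ proj₂ G≐)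
    where
    I = interval (suc (suc m)) t
    F₀≐ : (P ++ interval (suc m) (suc t)) ≐ (I ++ suc m ∷ P)
    F₀≐ = ≐-trans (++-≐ ≐-refl (interval-∷ (suc m) t))
            (↭⇒≐ (↭-trans (++-comm P (suc m ∷ I)) (↭-sym (shift (suc m) I P))))
    below-I : ∀ {y} → y ∈ suc m ∷ P → y ∉ I
    below-I y∈ y∈I = 1+n≰n (≤-trans (proj₁ (∈-interval⁻ y∈I)) (Pairs-∷-≤ ps y∈))

  coneGluing : 1 ≤ t → p + p ≤ m →
    ConeGluing (ΓFacet (pairsThen p t) n) (ΓFacet (pairsThen p t) (suc n)) (KFacet′ p t m) (suc n)
  coneGluing 1≤t 2p≤m = record
    { v∉Γ      = ΓFacet-∌
    ; K-resp-≐ = KFacet′-resp-≐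
    ; K⊆∂Γ     = K⊆∂Γ 1≤t 2p≤m
    ; Γ⊆Γ⁺     = ΓFacet-suc
    ; cone⊆Γ⁺  = cone∈Γ⁺
    ; Γ⁺-split = Γ⁺-split
    }

KFacet⇔KFacet′ : ∀ d m {G} → KFacet d (suc m + topSize d) G ⇔ KFacet′ (pairs d) (topSize d) m G
KFacet⇔KFacet′ d m = mk⇔ to from
  where
  t = topSize d
  chain-bound : suc m + t ∸ t ≡ suc m
  chain-bound = m+n∸n≡m (suc m) t
  top-start : suc (suc m + t) ∸ t ≡ suc (suc m)
  top-start = m+n∸n≡m (suc (suc m)) t
  rebound : ∀ {b b′ T} → b ≡ b′ →
    Chain 1 (replicate (pairs d) 2) b T → Chain 1 (replicate (pairs d) 2) b′ T
  rebound {T = T} = subst (λ b → Chain 1 (replicate (pairs d) 2) b T)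
  to : ∀ {G} → KFacet d (suc m + t) G → KFacet′ (pairs d) t m G
  to (T , (T′ , c , T≐T′) , G≐) with PairChain⇒Pairs (pairs d) (rebound chain-bound c)
  ... | T″ , ts , T′≐T″ =
    T″ , ts ,
    ≐-trans G≐ (++-≐ (≐-reflexive (cong (λ a → interval a t) top-start)) (≐-trans T≐T′ T′≐T″))
  from : ∀ {G} → KFacet′ (pairs d) t m G → KFacet d (suc m + t) G
  from (T , ts , G≐) with Pairs⇒PairChain ts
  ... | T′ , c , T≐T′ =
    T , (T′ , rebound (sym chain-bound) c , T≐T′) ,
    ≐-trans G≐ (++-≐ (≐-reflexive (cong (λ a → interval a t) (sym top-start))) ≐-refl)

Jseq≡pairsThen : ∀ d → Jseq d ≡ pairsThen (pairs d) (topSize d)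
Jseq≡pairsThen d with isEven d
... | true  = refl
... | false = refl

1≤topSize : ∀ d → 1 ≤ topSize d
1≤topSize d with isEven d
... | true  = s≤s z≤n
... | false = s≤s z≤n

halves+topSize : ∀ d → ⌊ d /2⌋ + ⌊ d /2⌋ + topSize d ≡ suc (suc d)
halves+topSize zero = refl
halves+topSize (suc zero) = refl
halves+topSize (suc (suc d)) =
  cong suc (trans (cong (_+ topSize d) (+-suc ⌊ d /2⌋ ⌊ d /2⌋)) (cong suc (halves+topSize d)))

above-dimension : ∀ d n → 2 ≤ d → d < n → Σ ℕ λ m → pairs d + pairs d ≤ m × suc m + topSize d ≡ n
above-dimension (suc zero) _ (s≤s ()) _
above-dimension (suc (suc d)) n _ d<n with m≤n⇒∃[o]m+o≡n d<n
... | o , 3+d+o≡n = h + h + o , m≤m+n (h + h) o , n≡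
  where
  h = ⌊ d /2⌋
  t = topSize d
  n≡ : suc (h + h + o) + t ≡ n
  n≡ = begin
    suc (h + h + o) + t    ≡⟨ cong suc (+-assoc (h + h) o t) ⟩
    suc (h + h + (o + t))  ≡⟨ cong (λ x → suc (h + h + x)) (+-comm o t) ⟩
    suc (h + h + (t + o))  ≡⟨ cong suc (sym (+-assoc (h + h) t o)) ⟩
    suc (h + h + t + o)    ≡⟨ cong (λ x → suc x + o) (halves+topSize d) ⟩
    suc (suc (suc d)) + o  ≡⟨ 3+d+o≡n ⟩
    n                      ∎
    where open ≡-Reasoning

D-coneGluing : ∀ d m → pairs d + pairs d ≤ m →
  ConeGluing (ΓFacet (Jseq d) (suc m + topSize d)) (ΓFacet (Jseq d) (suc (suc m + topSize d)))
             (KFacet d (suc m + topSize d)) (suc (suc m + topSize d))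
D-coneGluing d m 2p≤m =
  subst (λ J → ConeGluing (ΓFacet J n) (ΓFacet J (suc n)) (KFacet d n) (suc n))
    (sym (Jseq≡pairsThen d))
    (ConeGluing-respᴷ (KFacet⇔KFacet′ d m)
      (Gluing.coneGluing (pairs d) (topSize d) m (1≤topSize d) 2p≤m))
  where
  n = suc m + topSize d

lemma4p9 : ∀ (d n : ℕ) → 4 ≤ d → d < n →
    (∀ S → Face (KFacet d n) S → Face (DFacet d n) S) ×
    (∀ S → DFacet d (suc n) S ⇔
      ((DFacet d n S × ¬ KFacet d n S) ⊎
       (Σ VSet λ G → BoundaryFacet (KFacet d n) G × S ≐ (suc n ∷ G))))
lemma4p9 d n 4≤d d<n with above-dimension d n (≤-trans (s≤s (s≤s z≤n)) 4≤d) d<n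
... | m , 2p≤m , refl = Face-K⇒Face-∂Γ gluing , ∂Γ⁺⇔glued gluing
  where
  gluing = D-coneGluing d m 2p≤m
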